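{- Let $r_1,r_2,r_3$ be integers, each $\ge 3$, pairwise coprime, $\theta=\{r_1,r_2,r_3\}$, and \[ Q_\theta(z)=\frac{(z^{r_1r_2r_3}-1)(z^{r_1}-1)(z^{r_2}-1)(z^{r_3}-1)}{(z^{r_2r_3}-1)(z^{r_3r_1}-1)(z^{r_1r_2}-1)(z-1)} \] (a polynomial). For every integer $m$ let $a_m$ be the coefficient of $z^m$ in $Q_\theta$ (zero outside $0\le m\le\deg Q_\theta$). Then for every integer $m$ and every pair $i\ne j$, \[ |a_m-a_{m-r_ir_j}|\le 2 . \] Moreover, writing $\theta=\{p,q,r\}$ (any labelling of the three parameters), if $r\ge p+q$ then $|a_m-a_{m-pq}|\le 1$ for every integer $m$. -}

module Defs where

open import Data.Nat using (ℕ; zero; suc)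
open import Data.Integer using (ℤ; +_; -[1+_]; _+_; _*_; -_)
open import Data.List using (List; []; _∷_; map; replicate; _++_)
open import Data.Fin as Fin using (Fin)
import Data.Nat
open import Relation.Binary.PropositionalEquality using (_≡_)

-- Polynomials over ℤ as coefficient lists, lowest degree first.
Poly : Set
Poly = List ℤ

coeff : Poly → ℕ → ℤ
coeff []       k       = + 0
coeff (a ∷ p)  zero    = a
coeff (a ∷ p)  (suc k) = coeff p k

-- coefficient of z^m for an integer m (zero for m < 0, and for m > degree)
coeffℤ : Poly → ℤ → ℤ
coeffℤ p (+ n)    = coeff p n
coeffℤ p -[1+ n ] = + 0

_⊕_ : Poly → Poly → Poly
[]      ⊕ q       = q
(a ∷ p) ⊕ []      = a ∷ p
(a ∷ p) ⊕ (b ∷ q) = (a + b) ∷ (p ⊕ q)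

_⊛_ : Poly → Poly → Poly
[]      ⊛ q = []
(a ∷ p) ⊛ q = map (a *_) q ⊕ (+ 0 ∷ (p ⊛ q))

infixl 6 _⊕_
infixl 7 _⊛_
infix 4 _≈ₚ_

zpow-1 : ℕ → Poly
zpow-1 n = (replicate n (+ 0) ++ (+ 1 ∷ [])) ⊕ (- (+ 1) ∷ [])

_≈ₚ_ : Poly → Poly → Set
p ≈ₚ q = ∀ k → coeff p k ≡ coeff q k

IsQθ : (Fin 3 → ℕ) → Poly → Set
IsQθ r Q =
  Q ⊛ (zpow-1 (r₂ Data.Nat.* r₃) ⊛ zpow-1 (r₃ Data.Nat.* r₁) ⊛ zpow-1 (r₁ Data.Nat.* r₂) ⊛ zpow-1 1)
  ≈ₚ (zpow-1 (r₁ Data.Nat.* r₂ Data.Nat.* r₃) ⊛ zpow-1 r₁ ⊛ zpow-1 r₂ ⊛ zpow-1 r₃)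
  where
  r₁ = r Fin.zero
  r₂ = r (Fin.suc Fin.zero)
  r₃ = r (Fin.suc (Fin.suc Fin.zero))

module Submission where

-- A polynomial is identified with its coefficient sequence
-- a : ℕ → ℤ; multiplication by zⁿ is the delay `shift n`, and multiplication
-- by zⁿ − 1 is `Δ n`.  The defining equation of Q_θ becomes an identity between
-- iterated differences (`Relation`), and the claim bounds Δ (p·q) a, θ = {p,q,t}.
-- For coprime p, q the series σ = (z^{pq} − 1)/((z^p − 1)(z^q − 1)) equals
-- (1 + z^q + ⋯ + z^{(p−1)q})/(z^p − 1); its coefficients lie in {0, −1}
-- because distinct i < p give distinct residues i·q mod p.  Dilating gives
-- F(z) = σ(zᵗ)(zᵗ − 1)/(z − 1), whose coefficients are those of σ repeated in
-- blocks of length t, and h = (z^p − 1)(z^q − 1)F satisfies the same relation as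
-- (z^{pq} − 1)Q_θ.  Every Δ n with n > 0 is injective, so Δ (p·q) a = h.  As
-- h(m) = F(m−p−q) − F(m−p) − F(m−q) + F(m), we get |h(m)| ≤ 2, and ≤ 1 when
-- p + q ≤ t since then the indices meet at most two blocks.

open import Defs
open import Data.Nat using (ℕ; _≤_; _+_; _*_)
open import Data.Nat.Coprimality using (Coprime)
open import Data.Integer using (ℤ; +_; ∣_∣) renaming (_-_ to _-ℤ_)
open import Data.Fin using (Fin)
open import Data.Product using (_×_)
open import Relation.Binary.PropositionalEquality using (_≢_)

open import Data.Nat using (zero; suc; _<_; _∸_; _/_; _%_; z≤n; s≤s; NonZero; _<?_; _≤?_)
open import Data.Nat.Base using (>-nonZero; >-nonZero⁻¹)
import Data.Nat.Properties as ℕP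
import Data.Nat.DivMod as ℕDiv
open import Data.Nat.Divisibility using (_∣_; _∣?_; _∣0; ∣-refl; ∣⇒≤; ∣m+n∣m⇒∣n; ∣m∸n∣n⇒∣m; n∣m*n)
open import Data.Nat.Coprimality using (coprime-divisor)
open import Data.Nat.Induction using (<-rec)
open import Data.Nat.Tactic.RingSolver using () renaming (solve-∀ to ℕ-solve-∀)
open import Data.Integer using (-[1+_]; 0ℤ; -1ℤ) renaming (_+_ to _+ℤ_; _*_ to _*ℤ_; -_ to -ℤ_)
import Data.Integer.Properties as ℤP
open import Data.Integer.Tactic.RingSolver using (solve-∀)
open import Data.Fin.Patterns using (0F; 1F; 2F)
open import Data.List using (List; []; _∷_; _++_; map; replicate)
open import Data.List.Relation.Binary.Permutation.Propositional as ↭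
  using (_↭_; ↭-prep; ↭-swap; ↭-refl; ↭-sym; ↭-trans; ↭-reflexive)
open import Data.List.Relation.Binary.Permutation.Propositional.Properties
  using (++-comm) renaming (shift to ↭-shift)
open import Data.Product using (_,_; proj₁; proj₂; ∃-syntax)
open import Data.Sum using (_⊎_; inj₁; inj₂)
open import Data.Empty using (⊥; ⊥-elim)
open import Relation.Nullary using (Dec; yes; no; ¬_)
open import Relation.Binary.PropositionalEquality
  using (_≡_; refl; sym; trans; cong; cong₂; subst; _≗_; _→-setoid_; module ≡-Reasoning)
import Relation.Binary.Reasoning.Setoid as SetoidReasoning

-- Integer sequences, read as formal power series ∑ f(k) zᵏ.
Seq : Set
Seq = ℕ → ℤ

module ≗-Reasoning = SetoidReasoning (ℕ →-setoid ℤ)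

-- shift n f is zⁿ·f: the sequence delayed by n places.
shift : ℕ → Seq → Seq
shift zero    f k       = f k
shift (suc n) f zero    = 0ℤ
shift (suc n) f (suc k) = shift n f k

-- Δ n f is (zⁿ − 1)·f.
Δ : ℕ → Seq → Seq
Δ n f k = shift n f k -ℤ f k

δ : Seq
δ = coeff (+ 1 ∷ [])

shift-cong : ∀ n {f g : Seq} → f ≗ g → shift n f ≗ shift n g
shift-cong zero    f≗g k       = f≗g k
shift-cong (suc n) f≗g zero    = refl
shift-cong (suc n) f≗g (suc k) = shift-cong n f≗g k

shift-map : ∀ (u : ℤ → ℤ) → u 0ℤ ≡ 0ℤ → ∀ n (f : Seq) →
            shift n (λ j → u (f j)) ≗ λ k → u (shift n f k)
shift-map u u0 zero    f k       = refl
shift-map u u0 (suc n) f zero    = sym u0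
shift-map u u0 (suc n) f (suc k) = shift-map u u0 n f k

shift-map₂ : ∀ (_∙_ : ℤ → ℤ → ℤ) → 0ℤ ∙ 0ℤ ≡ 0ℤ → ∀ n (f g : Seq) →
             shift n (λ j → f j ∙ g j) ≗ λ k → shift n f k ∙ shift n g k
shift-map₂ _∙_ 0∙0 zero    f g k       = refl
shift-map₂ _∙_ 0∙0 (suc n) f g zero    = sym 0∙0
shift-map₂ _∙_ 0∙0 (suc n) f g (suc k) = shift-map₂ _∙_ 0∙0 n f g k

shift-zero : ∀ n → shift n (λ _ → 0ℤ) ≗ λ _ → 0ℤ
shift-zero n = shift-map (λ _ → 0ℤ) refl n (λ _ → 0ℤ)

shift-shift : ∀ m n (f : Seq) → shift m (shift n f) ≗ shift (m + n) f
shift-shift zero    n f k       = refl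
shift-shift (suc m) n f zero    = refl
shift-shift (suc m) n f (suc k) = shift-shift m n f k

shift-comm : ∀ m n (f : Seq) → shift m (shift n f) ≗ shift n (shift m f)
shift-comm m n f k = begin
  shift m (shift n f) k ≡⟨ shift-shift m n f k ⟩
  shift (m + n) f k     ≡⟨ cong (λ l → shift l f k) (ℕP.+-comm m n) ⟩
  shift (n + m) f k     ≡⟨ sym (shift-shift n m f k) ⟩
  shift n (shift m f) k ∎
  where open ≡-Reasoning

shift-< : ∀ n (f : Seq) k → k < n → shift n f k ≡ 0ℤ
shift-< (suc n) f zero    _         = refl
shift-< (suc n) f (suc k) (s≤s k<n) = shift-< n f k k<n

shift-≥ : ∀ n (f : Seq) k → n ≤ k → shift n f k ≡ f (k ∸ n)
shift-≥ zero    f k       _         = refl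
shift-≥ (suc n) f (suc k) (s≤s n≤k) = shift-≥ n f k n≤k

shift-cases : ∀ n (f : Seq) k → shift n f k ≡ 0ℤ ⊎ (n ≤ k × shift n f k ≡ f (k ∸ n))
shift-cases n f k with k <? n
... | yes k<n = inj₁ (shift-< n f k k<n)
... | no  k≮n = inj₂ (ℕP.≮⇒≥ k≮n , shift-≥ n f k (ℕP.≮⇒≥ k≮n))

shift-agree : ∀ n .{{_ : NonZero n}} {f g : Seq} k →
              (∀ {j} → j < k → f j ≡ g j) → shift n f k ≡ shift n g k
shift-agree n {f} {g} k below with k <? n
... | yes k<n = trans (shift-< n f k k<n) (sym (shift-< n g k k<n))
... | no  k≮n = begin
  shift n f k  ≡⟨ shift-≥ n f k n≤k ⟩
  f (k ∸ n)    ≡⟨ below (ℕP.∸-monoʳ-< {k} {n} {0} (>-nonZero⁻¹ n) n≤k) ⟩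
  g (k ∸ n)    ≡⟨ sym (shift-≥ n g k n≤k) ⟩
  shift n g k  ∎
  where
  open ≡-Reasoning
  n≤k = ℕP.≮⇒≥ k≮n

Δ-cong : ∀ n {f g : Seq} → f ≗ g → Δ n f ≗ Δ n g
Δ-cong n f≗g k = cong₂ _-ℤ_ (shift-cong n f≗g k) (f≗g k)

Δ-≡ : ∀ {m n} → m ≡ n → (f : Seq) → Δ m f ≗ Δ n f
Δ-≡ refl f k = refl

Δ-+ : ∀ n (f g : Seq) → Δ n (λ j → f j +ℤ g j) ≗ λ k → Δ n f k +ℤ Δ n g k
Δ-+ n f g k =
  trans (cong (_-ℤ (f k +ℤ g k)) (shift-map₂ _+ℤ_ refl n f g k))
        (interchange (shift n f k) (shift n g k) (f k) (g k))
  where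
  interchange : ∀ (a b c d : ℤ) → a +ℤ b -ℤ (c +ℤ d) ≡ (a -ℤ c) +ℤ (b -ℤ d)
  interchange = solve-∀

Δ-scale : ∀ n (c : ℤ) (f : Seq) → Δ n (λ j → c *ℤ f j) ≗ λ k → c *ℤ Δ n f k
Δ-scale n c f k =
  trans (cong (_-ℤ c *ℤ f k) (shift-map (c *ℤ_) (ℤP.*-zeroʳ c) n f k))
        (factor c (shift n f k) (f k))
  where
  factor : ∀ (c a b : ℤ) → c *ℤ a -ℤ c *ℤ b ≡ c *ℤ (a -ℤ b)
  factor = solve-∀

Δ-shift : ∀ m n (f : Seq) → Δ m (shift n f) ≗ shift n (Δ m f)
Δ-shift m n f k =
  trans (cong (_-ℤ shift n f k) (shift-comm m n f k))
        (sym (shift-map₂ _-ℤ_ refl n (shift m f) f k))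

Δ-Δ : ∀ m n (f : Seq) k →
      Δ m (Δ n f) k ≡ shift (m + n) f k -ℤ shift m f k -ℤ shift n f k +ℤ f k
Δ-Δ m n f k =
  trans (cong (_-ℤ Δ n f k)
              (trans (shift-map₂ _-ℤ_ refl m (shift n f) f k)
                     (cong (_-ℤ shift m f k) (shift-shift m n f k))))
        (expand (shift (m + n) f k) (shift m f k) (shift n f k) (f k))
  where
  expand : ∀ (a b c d : ℤ) → (a -ℤ b) -ℤ (c -ℤ d) ≡ a -ℤ b -ℤ c +ℤ d
  expand = solve-∀

Δ-comm : ∀ m n (f : Seq) → Δ m (Δ n f) ≗ Δ n (Δ m f)
Δ-comm m n f k = begin
  Δ m (Δ n f) k
    ≡⟨ Δ-Δ m n f k ⟩
  shift (m + n) f k -ℤ shift m f k -ℤ shift n f k +ℤ f k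
    ≡⟨ cong (λ l → shift l f k -ℤ shift m f k -ℤ shift n f k +ℤ f k) (ℕP.+-comm m n) ⟩
  shift (n + m) f k -ℤ shift m f k -ℤ shift n f k +ℤ f k
    ≡⟨ swap-middle (shift (n + m) f k) (shift m f k) (shift n f k) (f k) ⟩
  shift (n + m) f k -ℤ shift n f k -ℤ shift m f k +ℤ f k
    ≡⟨ sym (Δ-Δ n m f k) ⟩
  Δ n (Δ m f) k ∎
  where
  open ≡-Reasoning
  swap-middle : ∀ (a b c d : ℤ) → a -ℤ b -ℤ c +ℤ d ≡ a -ℤ c -ℤ b +ℤ d
  swap-middle = solve-∀

-- For n > 0, multiplication by zⁿ − 1 is injective: f is recovered from Δ n f
-- by strong induction, as f k = shift n f k − Δ n f k.
Δ-injective : ∀ n .{{_ : NonZero n}} {f g : Seq} → Δ n f ≗ Δ n g → f ≗ g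
Δ-injective n {f} {g} Δf≗Δg = <-rec (λ k → f k ≡ g k) step
  where
  recover : ∀ (s x : ℤ) → x ≡ s -ℤ (s -ℤ x)
  recover = solve-∀
  step : ∀ k → (∀ {j} → j < k → f j ≡ g j) → f k ≡ g k
  step k below = begin
    f k                     ≡⟨ recover (shift n f k) (f k) ⟩
    shift n f k -ℤ Δ n f k  ≡⟨ cong₂ _-ℤ_ (shift-agree n k below) (Δf≗Δg k) ⟩
    shift n g k -ℤ Δ n g k  ≡⟨ sym (recover (shift n g k) (g k)) ⟩
    g k                     ∎
    where open ≡-Reasoning

Δs : List ℕ → Seq → Seq
Δs []       f = f
Δs (n ∷ ns) f = Δ n (Δs ns f)

Δs-cong : ∀ ns {f g : Seq} → f ≗ g → Δs ns f ≗ Δs ns g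
Δs-cong []       f≗g = f≗g
Δs-cong (n ∷ ns) f≗g = Δ-cong n (Δs-cong ns f≗g)

Δs-perm : ∀ {ns ms} → ns ↭ ms → (f : Seq) → Δs ns f ≗ Δs ms f
Δs-perm ↭.refl             f k = refl
Δs-perm (↭.prep n p)       f   = Δ-cong n (Δs-perm p f)
Δs-perm (↭.swap n m p)     f k =
  trans (Δ-comm n m _ k) (Δ-cong m (Δ-cong n (Δs-perm p f)) k)
Δs-perm (↭.trans p p′)     f k = trans (Δs-perm p f k) (Δs-perm p′ f k)

coeff-⊕ : ∀ (X Y : Poly) k → coeff (X ⊕ Y) k ≡ coeff X k +ℤ coeff Y k
coeff-⊕ []      Y       k       = sym (ℤP.+-identityˡ (coeff Y k))
coeff-⊕ (a ∷ X) []      k       = sym (ℤP.+-identityʳ (coeff (a ∷ X) k))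
coeff-⊕ (a ∷ X) (b ∷ Y) zero    = refl
coeff-⊕ (a ∷ X) (b ∷ Y) (suc k) = coeff-⊕ X Y k

coeff-scale : ∀ c (Y : Poly) k → coeff (map (c *ℤ_) Y) k ≡ c *ℤ coeff Y k
coeff-scale c []      k       = sym (ℤP.*-zeroʳ c)
coeff-scale c (b ∷ Y) zero    = refl
coeff-scale c (b ∷ Y) (suc k) = coeff-scale c Y k

coeff-zero∷ : ∀ (X : Poly) → coeff (0ℤ ∷ X) ≗ shift 1 (coeff X)
coeff-zero∷ X zero    = refl
coeff-zero∷ X (suc k) = refl

coeff-⊛-∷ : ∀ a (X Y : Poly) →
            coeff ((a ∷ X) ⊛ Y) ≗ λ k → a *ℤ coeff Y k +ℤ shift 1 (coeff (X ⊛ Y)) k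
coeff-⊛-∷ a X Y k =
  trans (coeff-⊕ (map (a *ℤ_) Y) (0ℤ ∷ (X ⊛ Y)) k)
        (cong₂ _+ℤ_ (coeff-scale a Y k) (coeff-zero∷ (X ⊛ Y) k))

⊛-Δ : ∀ (X Y Y′ : Poly) n → coeff Y′ ≗ Δ n (coeff Y) → coeff (X ⊛ Y′) ≗ Δ n (coeff (X ⊛ Y))
⊛-Δ []      Y Y′ n _   k = sym (cong (_-ℤ 0ℤ) (shift-zero n k))
⊛-Δ (a ∷ X) Y Y′ n Y′≗ΔY k = begin
  coeff ((a ∷ X) ⊛ Y′) k
    ≡⟨ coeff-⊛-∷ a X Y′ k ⟩
  a *ℤ coeff Y′ k +ℤ shift 1 (coeff (X ⊛ Y′)) k
    ≡⟨ cong₂ (λ u v → a *ℤ u +ℤ v) (Y′≗ΔY k) (shift-cong 1 (⊛-Δ X Y Y′ n Y′≗ΔY) k) ⟩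
  a *ℤ Δ n (coeff Y) k +ℤ shift 1 (Δ n (coeff (X ⊛ Y))) k
    ≡⟨ cong₂ _+ℤ_ (sym (Δ-scale n a (coeff Y) k)) (sym (Δ-shift n 1 (coeff (X ⊛ Y)) k)) ⟩
  Δ n (λ j → a *ℤ coeff Y j) k +ℤ Δ n (shift 1 (coeff (X ⊛ Y))) k
    ≡⟨ sym (Δ-+ n _ _ k) ⟩
  Δ n (λ j → a *ℤ coeff Y j +ℤ shift 1 (coeff (X ⊛ Y)) j) k
    ≡⟨ Δ-cong n (λ j → sym (coeff-⊛-∷ a X Y j)) k ⟩
  Δ n (coeff ((a ∷ X) ⊛ Y)) k ∎
  where open ≡-Reasoning

coeff-⊛-one : ∀ (X : Poly) → coeff (X ⊛ (+ 1 ∷ [])) ≗ coeff X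
coeff-⊛-one []      k       = refl
coeff-⊛-one (a ∷ X) zero    =
  trans (coeff-⊛-∷ a X (+ 1 ∷ []) zero)
        (trans (ℤP.+-identityʳ (a *ℤ + 1)) (ℤP.*-identityʳ a))
coeff-⊛-one (a ∷ X) (suc k) =
  trans (coeff-⊛-∷ a X (+ 1 ∷ []) (suc k))
        (trans (cong (_+ℤ coeff (X ⊛ (+ 1 ∷ [])) k) (ℤP.*-zeroʳ a))
               (trans (ℤP.+-identityˡ _) (coeff-⊛-one X k)))

coeff-monomial : ∀ n → coeff (replicate n 0ℤ ++ (+ 1 ∷ [])) ≗ shift n δ
coeff-monomial zero    k       = refl
coeff-monomial (suc n) zero    = refl
coeff-monomial (suc n) (suc k) = coeff-monomial n k

coeff-minus-one : coeff (-ℤ (+ 1) ∷ []) ≗ λ k → -ℤ δ k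
coeff-minus-one zero    = refl
coeff-minus-one (suc k) = refl

coeff-zpow-1 : ∀ n → coeff (zpow-1 n) ≗ Δ n δ
coeff-zpow-1 n k =
  trans (coeff-⊕ (replicate n 0ℤ ++ (+ 1 ∷ [])) (-ℤ (+ 1) ∷ []) k)
        (cong₂ _+ℤ_ (coeff-monomial n k) (coeff-minus-one k))

coeff-⊛-zpow-1 : ∀ (X : Poly) n → coeff (X ⊛ zpow-1 n) ≗ Δ n (coeff X)
coeff-⊛-zpow-1 X n k =
  trans (⊛-Δ X (+ 1 ∷ []) (zpow-1 n) n (coeff-zpow-1 n) k) (Δ-cong n (coeff-⊛-one X) k)

coeff-⊛-⊛-zpow-1 : ∀ (X W : Poly) n → coeff (X ⊛ (W ⊛ zpow-1 n)) ≗ Δ n (coeff (X ⊛ W))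
coeff-⊛-⊛-zpow-1 X W n = ⊛-Δ X W (W ⊛ zpow-1 n) n (coeff-⊛-zpow-1 W n)

coeff-⊛-product : ∀ (X : Poly) n₁ n₂ n₃ n₄ →
  coeff (X ⊛ (zpow-1 n₁ ⊛ zpow-1 n₂ ⊛ zpow-1 n₃ ⊛ zpow-1 n₄)) ≗ Δs (n₄ ∷ n₃ ∷ n₂ ∷ n₁ ∷ []) (coeff X)
coeff-⊛-product X n₁ n₂ n₃ n₄ = begin
  coeff (X ⊛ (zpow-1 n₁ ⊛ zpow-1 n₂ ⊛ zpow-1 n₃ ⊛ zpow-1 n₄))
    ≈⟨ coeff-⊛-⊛-zpow-1 X (zpow-1 n₁ ⊛ zpow-1 n₂ ⊛ zpow-1 n₃) n₄ ⟩
  Δ n₄ (coeff (X ⊛ (zpow-1 n₁ ⊛ zpow-1 n₂ ⊛ zpow-1 n₃)))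
    ≈⟨ Δ-cong n₄ (coeff-⊛-⊛-zpow-1 X (zpow-1 n₁ ⊛ zpow-1 n₂) n₃) ⟩
  Δs (n₄ ∷ n₃ ∷ []) (coeff (X ⊛ (zpow-1 n₁ ⊛ zpow-1 n₂)))
    ≈⟨ Δs-cong (n₄ ∷ n₃ ∷ []) (coeff-⊛-⊛-zpow-1 X (zpow-1 n₁) n₂) ⟩
  Δs (n₄ ∷ n₃ ∷ n₂ ∷ []) (coeff (X ⊛ zpow-1 n₁))
    ≈⟨ Δs-cong (n₄ ∷ n₃ ∷ n₂ ∷ []) (coeff-⊛-zpow-1 X n₁) ⟩
  Δs (n₄ ∷ n₃ ∷ n₂ ∷ n₁ ∷ []) (coeff X) ∎
  where open ≗-Reasoning

coeff-product : ∀ n₁ n₂ n₃ n₄ →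
  coeff (zpow-1 n₁ ⊛ zpow-1 n₂ ⊛ zpow-1 n₃ ⊛ zpow-1 n₄) ≗ Δs (n₄ ∷ n₃ ∷ n₂ ∷ n₁ ∷ []) δ
coeff-product n₁ n₂ n₃ n₄ = begin
  coeff (zpow-1 n₁ ⊛ zpow-1 n₂ ⊛ zpow-1 n₃ ⊛ zpow-1 n₄)
    ≈⟨ coeff-⊛-zpow-1 (zpow-1 n₁ ⊛ zpow-1 n₂ ⊛ zpow-1 n₃) n₄ ⟩
  Δ n₄ (coeff (zpow-1 n₁ ⊛ zpow-1 n₂ ⊛ zpow-1 n₃))
    ≈⟨ Δ-cong n₄ (coeff-⊛-zpow-1 (zpow-1 n₁ ⊛ zpow-1 n₂) n₃) ⟩
  Δs (n₄ ∷ n₃ ∷ []) (coeff (zpow-1 n₁ ⊛ zpow-1 n₂))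
    ≈⟨ Δs-cong (n₄ ∷ n₃ ∷ []) (coeff-⊛-zpow-1 (zpow-1 n₁) n₂) ⟩
  Δs (n₄ ∷ n₃ ∷ n₂ ∷ []) (coeff (zpow-1 n₁))
    ≈⟨ Δs-cong (n₄ ∷ n₃ ∷ n₂ ∷ []) (coeff-zpow-1 n₁) ⟩
  Δs (n₄ ∷ n₃ ∷ n₂ ∷ n₁ ∷ []) δ ∎
  where open ≗-Reasoning

-- The defining identity of Q_θ for θ = {p, q, t}, on a coefficient sequence a:
--   a·(z − 1)(z^{tp} − 1)(z^{qt} − 1)(z^{pq} − 1) = (z^p − 1)(z^q − 1)(zᵗ − 1)(z^{pqt} − 1).
Relation : Seq → ℕ → ℕ → ℕ → Set
Relation a p q t = Δs (1 ∷ t * p ∷ q * t ∷ p * q ∷ []) a ≗ Δs (p ∷ q ∷ t ∷ p * q * t ∷ []) δ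

*-rotate : ∀ x y z → x * y * z ≡ y * z * x
*-rotate = ℕ-solve-∀

-- The products t·p, q·t, p·q are permuted cyclically by p ↦ q ↦ t ↦ p,
-- so the relation is invariant under rotating its parameters.
Relation-rotate : ∀ {a p q t} → Relation a p q t → Relation a q t p
Relation-rotate {a} {p} {q} {t} rel k = begin
  Δs (1 ∷ p * q ∷ t * p ∷ q * t ∷ []) a k   ≡⟨ Δs-perm (↭-sym lhs-order) a k ⟩
  Δs (1 ∷ t * p ∷ q * t ∷ p * q ∷ []) a k   ≡⟨ rel k ⟩
  Δs (p ∷ q ∷ t ∷ p * q * t ∷ []) δ k       ≡⟨ Δs-perm rhs-order δ k ⟩
  Δs (q ∷ t ∷ p ∷ q * t * p ∷ []) δ k       ∎
  where
  open ≡-Reasoning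
  lhs-order : 1 ∷ t * p ∷ q * t ∷ p * q ∷ [] ↭ 1 ∷ p * q ∷ t * p ∷ q * t ∷ []
  lhs-order = ↭-prep 1 (↭-shift (p * q) (t * p ∷ q * t ∷ []) [])
  rhs-order : p ∷ q ∷ t ∷ p * q * t ∷ [] ↭ q ∷ t ∷ p ∷ q * t * p ∷ []
  rhs-order = ↭-trans (↭-sym (↭-shift p (q ∷ t ∷ []) (p * q * t ∷ [])))
                      (↭-reflexive (cong (λ N → q ∷ t ∷ p ∷ N ∷ []) (*-rotate p q t)))

IsQθ⇒Relation : ∀ (r : Fin 3 → ℕ) (Q : Poly) → IsQθ r Q → Relation (coeff Q) (r 1F) (r 2F) (r 0F)
IsQθ⇒Relation r Q isQ = begin
  Δs (1 ∷ x * y ∷ z * x ∷ y * z ∷ []) (coeff Q)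
    ≈⟨ coeff-⊛-product Q (y * z) (z * x) (x * y) 1 ⟨
  coeff (Q ⊛ (zpow-1 (y * z) ⊛ zpow-1 (z * x) ⊛ zpow-1 (x * y) ⊛ zpow-1 1))
    ≈⟨ isQ ⟩
  coeff (zpow-1 (x * y * z) ⊛ zpow-1 x ⊛ zpow-1 y ⊛ zpow-1 z)
    ≈⟨ coeff-product (x * y * z) x y z ⟩
  Δs (z ∷ y ∷ x ∷ x * y * z ∷ []) δ
    ≈⟨ Δs-perm (↭-swap z y (↭-reflexive (cong (λ N → x ∷ N ∷ []) (*-rotate x y z)))) δ ⟩
  Δs (y ∷ z ∷ x ∷ y * z * x ∷ []) δ ∎
  where
  open ≗-Reasoning
  x = r 0F
  y = r 1F
  z = r 2F

geom : ℕ → ℕ → Seq → Seq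
geom d zero    f k = 0ℤ
geom d (suc a) f k = geom d a f k +ℤ shift (a * d) f k

Δ-geom : ∀ d a (f : Seq) → Δ d (geom d a f) ≗ Δ (a * d) f
Δ-geom d zero    f k = trans (cong (_-ℤ 0ℤ) (shift-zero d k)) (sym (ℤP.+-inverseʳ (f k)))
Δ-geom d (suc a) f k = begin
  Δ d (geom d (suc a) f) k
    ≡⟨ Δ-+ d (geom d a f) (shift (a * d) f) k ⟩
  Δ d (geom d a f) k +ℤ (shift d (shift (a * d) f) k -ℤ shift (a * d) f k)
    ≡⟨ cong₂ (λ u v → u +ℤ (v -ℤ shift (a * d) f k)) (Δ-geom d a f k) (shift-shift d (a * d) f k) ⟩
  (shift (a * d) f k -ℤ f k) +ℤ (shift (d + a * d) f k -ℤ shift (a * d) f k)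
    ≡⟨ telescope (shift (a * d) f k) (f k) (shift (d + a * d) f k) ⟩
  Δ (suc a * d) f k ∎
  where
  open ≡-Reasoning
  telescope : ∀ (s x s′ : ℤ) → (s -ℤ x) +ℤ (s′ -ℤ s) ≡ s′ -ℤ x
  telescope = solve-∀

negIndicator : ∀ {P : Set} → Dec P → ℤ
negIndicator (yes _) = -1ℤ
negIndicator (no _)  = 0ℤ

negIndicator-yes : ∀ {P : Set} (d : Dec P) → P → negIndicator d ≡ -1ℤ
negIndicator-yes (yes _) _  = refl
negIndicator-yes (no ¬p) p  = ⊥-elim (¬p p)

negIndicator-no : ∀ {P : Set} (d : Dec P) → ¬ P → negIndicator d ≡ 0ℤ
negIndicator-no (yes p) ¬p = ⊥-elim (¬p p)
negIndicator-no (no _)  _  = refl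

negIndicator-cases : ∀ {P : Set} (d : Dec P) → negIndicator d ≡ 0ℤ ⊎ (negIndicator d ≡ -1ℤ × P)
negIndicator-cases (yes p) = inj₂ (refl , p)
negIndicator-cases (no _)  = inj₁ refl

-- multiples q is −1 at the multiples of q and 0 elsewhere: the series 1/(z^q − 1).
multiples : ℕ → Seq
multiples q k = negIndicator (q ∣? k)

multiples-periodic : ∀ q k → q ≤ k → multiples q (k ∸ q) ≡ multiples q k
multiples-periodic q k q≤k with q ∣? (k ∸ q) | q ∣? k
... | yes _        | yes _   = refl
... | no  _        | no  _   = refl
... | yes q∣k∸q    | no  q∤k = ⊥-elim (q∤k (∣m∸n∣n⇒∣m q q≤k q∣k∸q ∣-refl))
... | no  q∤k∸q    | yes q∣k =
  ⊥-elim (q∤k∸q (∣m+n∣m⇒∣n (subst (q ∣_) (sym (ℕP.m+[n∸m]≡n q≤k)) q∣k) ∣-refl))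

Δ-multiples : ∀ q .{{_ : NonZero q}} → Δ q (multiples q) ≗ δ
Δ-multiples q zero =
  cong₂ _-ℤ_ (shift-< q (multiples q) 0 (>-nonZero⁻¹ q)) (negIndicator-yes (q ∣? 0) (q ∣0))
Δ-multiples q (suc k) with suc k <? q
... | yes k<q =
  cong₂ _-ℤ_ (shift-< q (multiples q) (suc k) k<q)
             (negIndicator-no (q ∣? suc k) (λ q∣k → ℕP.<⇒≱ k<q (∣⇒≤ q∣k)))
... | no  k≮q =
  trans (cong (_-ℤ multiples q (suc k))
              (trans (shift-≥ q (multiples q) (suc k) q≤k) (multiples-periodic q (suc k) q≤k)))
        (ℤP.+-inverseʳ (multiples q (suc k)))
  where q≤k = ℕP.≮⇒≥ k≮q

IsNegBit : ℤ → Set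
IsNegBit x = x ≡ 0ℤ ⊎ x ≡ -1ℤ

-- For coprime p, q the series σ = (z^{pq} − 1)/((z^p − 1)(z^q − 1)), written as
-- (1 + z^q + ⋯ + z^{(p−1)q}) · 1/(z^p − 1), has all coefficients in {0, −1}.
module NegBitQuotient (p q : ℕ) .{{_ : NonZero p}} (p⊥q : Coprime p q) where

  σ : Seq
  σ = geom q p (multiples p)

  Δ-Δ-σ : Δ p (Δ q σ) ≗ Δ (p * q) δ
  Δ-Δ-σ = begin
    Δ p (Δ q σ)                      ≈⟨ Δ-cong p (Δ-geom q p (multiples p)) ⟩
    Δ p (Δ (p * q) (multiples p))    ≈⟨ Δ-comm p (p * q) (multiples p) ⟩
    Δ (p * q) (Δ p (multiples p))    ≈⟨ Δ-cong (p * q) (Δ-multiples p) ⟩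
    Δ (p * q) δ                      ∎
    where open ≗-Reasoning

  -- the i-th summand z^{iq}·multiples p is −1 at k exactly when Hit k i
  Hit : ℕ → ℕ → Set
  Hit k i = i * q ≤ k × p ∣ k ∸ i * q

  distinct-residues : ∀ {i j k} → i < j → j < p → Hit k i → Hit k j → ⊥
  distinct-residues {i} {j} {k} i<j j<p (_ , p∣k-iq) (jq≤k , p∣k-jq) =
    ℕP.<⇒≱ (ℕP.≤-<-trans (ℕP.m∸n≤m j i) j<p) (∣⇒≤ {{>-nonZero (ℕP.m<n⇒0<n∸m i<j)}} p∣j-i)
    where
    iq≤jq : i * q ≤ j * q
    iq≤jq = ℕP.*-monoˡ-≤ q (ℕP.<⇒≤ i<j)
    split : k ∸ i * q ≡ (k ∸ j * q) + (j ∸ i) * q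
    split = begin
      k ∸ i * q                      ≡⟨ cong (_∸ i * q) (sym (ℕP.m∸n+n≡m jq≤k)) ⟩
      (k ∸ j * q) + j * q ∸ i * q    ≡⟨ ℕP.+-∸-assoc (k ∸ j * q) iq≤jq ⟩
      (k ∸ j * q) + (j * q ∸ i * q)  ≡⟨ cong (λ n → (k ∸ j * q) + n) (sym (ℕP.*-distribʳ-∸ q j i)) ⟩
      (k ∸ j * q) + (j ∸ i) * q      ∎
      where open ≡-Reasoning
    p∣j-i : p ∣ j ∸ i
    p∣j-i = coprime-divisor p⊥q
              (subst (p ∣_) (ℕP.*-comm (j ∸ i) q) (∣m+n∣m⇒∣n (subst (p ∣_) split p∣k-iq) p∣k-jq))

  summand-cases : ∀ i k → shift (i * q) (multiples p) k ≡ 0ℤ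
                        ⊎ (shift (i * q) (multiples p) k ≡ -1ℤ × Hit k i)
  summand-cases i k with shift-cases (i * q) (multiples p) k
  ... | inj₁ is0 = inj₁ is0
  ... | inj₂ (iq≤k , eq) with negIndicator-cases (p ∣? (k ∸ i * q))
  ...   | inj₁ is0        = inj₁ (trans eq is0)
  ...   | inj₂ (is-1 , p∣) = inj₂ (trans eq is-1 , iq≤k , p∣)

  -- Each partial sum is 0, or −1 with a witnessing summand: two summands are
  -- never −1 at the same k.
  partial-sum-cases : ∀ a → a ≤ p → ∀ k →
    geom q a (multiples p) k ≡ 0ℤ ⊎ (geom q a (multiples p) k ≡ -1ℤ × ∃[ i ] (i < a × Hit k i))
  partial-sum-cases zero    _   k = inj₁ refl
  partial-sum-cases (suc a) a<p k with partial-sum-cases a (ℕP.<⇒≤ a<p) k | summand-cases a k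
  ... | inj₁ s≡0                   | inj₁ t≡0          = inj₁ (cong₂ _+ℤ_ s≡0 t≡0)
  ... | inj₁ s≡0                   | inj₂ (t≡-1 , hit) = inj₂ (cong₂ _+ℤ_ s≡0 t≡-1 , a , ℕP.≤-refl , hit)
  ... | inj₂ (s≡-1 , i , i<a , hit) | inj₁ t≡0          =
    inj₂ (cong₂ _+ℤ_ s≡-1 t≡0 , i , ℕP.m≤n⇒m≤1+n i<a , hit)
  ... | inj₂ (_ , i , i<a , hitᵢ)   | inj₂ (_ , hitₐ)   = ⊥-elim (distinct-residues i<a a<p hitᵢ hitₐ)

  σ-negBit : ∀ k → IsNegBit (σ k)
  σ-negBit k with partial-sum-cases p ℕP.≤-refl k
  ... | inj₁ σ≡0       = inj₁ σ≡0
  ... | inj₂ (σ≡-1 , _) = inj₂ σ≡-1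

-- dilate t f = f(zᵗ)·(1 + z + ⋯ + z^{t−1}): each coefficient of f repeated t times
dilate : (t : ℕ) .{{_ : NonZero t}} → Seq → Seq
dilate t f k = f (k / t)

module Dilation (t : ℕ) .{{_ : NonZero t}} where

  shift-t-dilate : ∀ (g : Seq) → shift t (dilate t g) ≗ dilate t (shift 1 g)
  shift-t-dilate g k with k <? t
  ... | yes k<t = trans (shift-< t (dilate t g) k k<t) (cong (shift 1 g) (sym (ℕDiv.m<n⇒m/n≡0 k<t)))
  ... | no  k≮t = trans (shift-≥ t (dilate t g) k t≤k) (cong (shift 1 g) (sym (ℕDiv.m/n≡1+[m∸n]/n t≤k)))
    where t≤k = ℕP.≮⇒≥ k≮t

  shift-dilate : ∀ n (f : Seq) → shift (n * t) (dilate t f) ≗ dilate t (shift n f)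
  shift-dilate zero    f k = refl
  shift-dilate (suc n) f k = begin
    shift (t + n * t) (dilate t f) k       ≡⟨ sym (shift-shift t (n * t) (dilate t f) k) ⟩
    shift t (shift (n * t) (dilate t f)) k ≡⟨ shift-cong t (shift-dilate n f) k ⟩
    shift t (dilate t (shift n f)) k       ≡⟨ shift-t-dilate (shift n f) k ⟩
    shift 1 (shift n f) (k / t)            ≡⟨ shift-shift 1 n f (k / t) ⟩
    shift (suc n) f (k / t)                ∎
    where open ≡-Reasoning

  Δ-dilate : ∀ n (f : Seq) → Δ (n * t) (dilate t f) ≗ dilate t (Δ n f)
  Δ-dilate n f k = cong (_-ℤ f (k / t)) (shift-dilate n f k)

  -- (z − 1)(1 + z + ⋯ + z^{t−1}) = zᵗ − 1, using δ = (z − 1)·(−1, −1, …).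
  Δ-dilate-δ : Δ 1 (dilate t δ) ≗ Δ t δ
  Δ-dilate-δ = begin
    Δ 1 (dilate t δ)                   ≈⟨ Δ-cong 1 (λ k → sym (Δ-minus-ones (k / t))) ⟩
    Δ 1 (dilate t (Δ 1 minus-ones))    ≈⟨ Δ-cong 1 (λ k → sym (Δ-dilate 1 minus-ones k)) ⟩
    Δ 1 (Δ (1 * t) minus-ones)         ≈⟨ Δ-comm 1 (1 * t) minus-ones ⟩
    Δ (1 * t) (Δ 1 minus-ones)         ≈⟨ Δ-cong (1 * t) Δ-minus-ones ⟩
    Δ (1 * t) δ                        ≈⟨ Δ-≡ (ℕP.*-identityˡ t) δ ⟩
    Δ t δ                              ∎
    where
    open ≗-Reasoning
    minus-ones : Seq
    minus-ones _ = -1ℤ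
    Δ-minus-ones : Δ 1 minus-ones ≗ δ
    Δ-minus-ones zero    = refl
    Δ-minus-ones (suc k) = refl

  block-index : ∀ k n → k < t → (k + n * t) / t ≡ n
  block-index k n k<t = begin
    (k + n * t) / t      ≡⟨ ℕDiv.+-distrib-/-∣ʳ k (n∣m*n n) ⟩
    k / t + n * t / t    ≡⟨ cong₂ _+_ (ℕDiv.m<n⇒m/n≡0 k<t) (ℕDiv.m*n/n≡m n t) ⟩
    n                    ∎
    where open ≡-Reasoning

  dilate-shift-within : ∀ (f : Seq) x k n → x ≤ k → k < t → shift x (dilate t f) (k + n * t) ≡ f n
  dilate-shift-within f x k n x≤k k<t = begin
    shift x (dilate t f) (k + n * t)  ≡⟨ shift-≥ x (dilate t f) (k + n * t) (ℕP.≤-trans x≤k (ℕP.m≤m+n k (n * t))) ⟩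
    f ((k + n * t ∸ x) / t)           ≡⟨ cong (λ l → f (l / t)) (ℕP.+-∸-comm (n * t) x≤k) ⟩
    f ((k ∸ x + n * t) / t)           ≡⟨ cong f (block-index (k ∸ x) n (ℕP.≤-<-trans (ℕP.m∸n≤m k x) k<t)) ⟩
    f n                               ∎
    where open ≡-Reasoning

  dilate-shift-across : ∀ (f : Seq) x k n → k < x → x ≤ t → shift x (dilate t f) (k + n * t) ≡ shift 1 f n
  dilate-shift-across f x k zero    k<x x≤t = shift-< x (dilate t f) (k + 0) (subst (_< x) (sym (ℕP.+-identityʳ k)) k<x)
  dilate-shift-across f x k (suc n) k<x x≤t = begin
    shift x (dilate t f) (k + (t + n * t))  ≡⟨ cong (shift x (dilate t f)) (sym (ℕP.+-assoc k t (n * t))) ⟩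
    shift x (dilate t f) (k + t + n * t)    ≡⟨ shift-≥ x (dilate t f) (k + t + n * t) (ℕP.≤-trans x≤k+t (ℕP.m≤m+n (k + t) (n * t))) ⟩
    f ((k + t + n * t ∸ x) / t)             ≡⟨ cong (λ l → f (l / t)) (ℕP.+-∸-comm (n * t) x≤k+t) ⟩
    f ((k + t ∸ x + n * t) / t)             ≡⟨ cong f (block-index (k + t ∸ x) n k+t∸x<t) ⟩
    f n                                     ∎
    where
    open ≡-Reasoning
    x≤k+t : x ≤ k + t
    x≤k+t = ℕP.≤-trans x≤t (ℕP.m≤n+m t k)
    k+t∸x<t : k + t ∸ x < t
    k+t∸x<t = ℕP.m<n+o⇒m∸n<o (k + t) x (ℕP.+-monoˡ-< t k<x)

open Dilation

negBit-distance : ∀ {x y} → IsNegBit x → IsNegBit y → ∣ x -ℤ y ∣ ≤ 1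
negBit-distance (inj₁ refl) (inj₁ refl) = z≤n
negBit-distance (inj₁ refl) (inj₂ refl) = s≤s z≤n
negBit-distance (inj₂ refl) (inj₁ refl) = s≤s z≤n
negBit-distance (inj₂ refl) (inj₂ refl) = z≤n

shift-negBit : ∀ {f : Seq} → (∀ k → IsNegBit (f k)) → ∀ n k → IsNegBit (shift n f k)
shift-negBit {f} bit n k with shift-cases n f k
... | inj₁ is0      = inj₁ is0
... | inj₂ (_ , eq) = subst IsNegBit (sym eq) (bit (k ∸ n))

-- A second difference f(m−p−q) − f(m−p) − f(m−q) + f(m) of a {0,−1}-valued
-- sequence pairs up into two differences of size at most 1.
second-difference-bound : ∀ p q {f : Seq} → (∀ k → IsNegBit (f k)) → ∀ m → ∣ Δ p (Δ q f) m ∣ ≤ 2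
second-difference-bound p q {f} bit m = begin
  ∣ Δ p (Δ q f) m ∣                                 ≡⟨ cong ∣_∣ (trans (Δ-Δ p q f m) (regroup a b c d)) ⟩
  ∣ (a -ℤ b) +ℤ (d -ℤ c) ∣                           ≤⟨ ℤP.∣i+j∣≤∣i∣+∣j∣ (a -ℤ b) (d -ℤ c) ⟩
  ∣ a -ℤ b ∣ + ∣ d -ℤ c ∣                            ≤⟨ ℕP.+-mono-≤ (negBit-distance (bit′ (p + q)) (bit′ p))
                                                                   (negBit-distance (bit m) (bit′ q)) ⟩
  2                                                 ∎
  where
  open ℕP.≤-Reasoning
  a = shift (p + q) f m
  b = shift p f m
  c = shift q f m
  d = f m
  bit′ : ∀ n → IsNegBit (shift n f m)
  bit′ n = shift-negBit bit n m
  regroup : ∀ (a b c d : ℤ) → a -ℤ b -ℤ c +ℤ d ≡ (a -ℤ b) +ℤ (d -ℤ c)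
  regroup = solve-∀

-- If p + q ≤ t, the indices m − p − q, m − p and m of the second difference of a
-- dilated {0,−1}-valued sequence meet at most two consecutive blocks, and
-- m − p − q shares the block of m − p unless m − p shares the block of m.  So
-- F(m−p−q) − F(m−p) + F(m) is again 0 or −1, and the difference with F(m−q)
-- is at most 1.
blocked-second-difference-bound : ∀ p q t .{{_ : NonZero t}} {f : Seq} → (∀ k → IsNegBit (f k)) →
  p + q ≤ t → ∀ m → ∣ Δ p (Δ q (dilate t f)) m ∣ ≤ 1
blocked-second-difference-bound p q t {f} bit p+q≤t m =
  subst (λ l → ∣ Δ p (Δ q F) l ∣ ≤ 1) (sym (ℕDiv.m≡m%n+[m/n]*n m t))
        (in-block (m % t) (m / t) (ℕDiv.m%n<n m t))
  where
  F = dilate t f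
  p≤t = ℕP.≤-trans (ℕP.m≤m+n p q) p+q≤t

  outer-cong : ∀ {a a′ b b′ c c′ : ℤ} → a ≡ a′ → b ≡ b′ → c ≡ c′ → a -ℤ b +ℤ c ≡ a′ -ℤ b′ +ℤ c′
  outer-cong a≡ b≡ c≡ = cong₂ _+ℤ_ (cong₂ _-ℤ_ a≡ b≡) c≡
  cancel-last : ∀ (u v : ℤ) → u -ℤ v +ℤ v ≡ u
  cancel-last = solve-∀
  cancel-first : ∀ (u v : ℤ) → u -ℤ u +ℤ v ≡ v
  cancel-first = solve-∀

  outer-negBit : ∀ k n → k < t →
    IsNegBit (shift (p + q) F (k + n * t) -ℤ shift p F (k + n * t) +ℤ F (k + n * t))
  outer-negBit k n k<t with p + q ≤? k | p ≤? k
  ... | yes p+q≤k | _       = subst IsNegBit (sym (trans values (cancel-last (f n) (f n)))) (bit n)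
    where
    values = outer-cong (dilate-shift-within t f (p + q) k n p+q≤k k<t)
                        (dilate-shift-within t f p k n (ℕP.≤-trans (ℕP.m≤m+n p q) p+q≤k) k<t)
                        (cong f (block-index t k n k<t))
  ... | no  p+q≰k | yes p≤k = subst IsNegBit (sym (trans values (cancel-last (shift 1 f n) (f n))))
                                    (shift-negBit bit 1 n)
    where
    values = outer-cong (dilate-shift-across t f (p + q) k n (ℕP.≰⇒> p+q≰k) p+q≤t)
                        (dilate-shift-within t f p k n p≤k k<t)
                        (cong f (block-index t k n k<t))
  ... | no  p+q≰k | no  p≰k = subst IsNegBit (sym (trans values (cancel-first (shift 1 f n) (f n)))) (bit n)
    where
    values = outer-cong (dilate-shift-across t f (p + q) k n (ℕP.≰⇒> p+q≰k) p+q≤t)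
                        (dilate-shift-across t f p k n (ℕP.≰⇒> p≰k) p≤t)
                        (cong f (block-index t k n k<t))

  in-block : ∀ k n → k < t → ∣ Δ p (Δ q F) (k + n * t) ∣ ≤ 1
  in-block k n k<t =
    subst (_≤ 1) (cong ∣_∣ (sym (trans (Δ-Δ p q F l) (regroup (shift (p + q) F l) (shift p F l) (shift q F l) (F l)))))
          (negBit-distance (outer-negBit k n k<t) (shift-negBit (λ j → bit (j / t)) q l))
    where
    l = k + n * t
    regroup : ∀ (a b c d : ℤ) → a -ℤ b -ℤ c +ℤ d ≡ (a -ℤ b +ℤ d) -ℤ c
    regroup = solve-∀

-- For θ = {p, q, t} with p, q coprime, the relation determines (z^{pq} − 1)·a:
-- it is the second difference (z^p − 1)(z^q − 1)·F of F(z) = σ(zᵗ)(zᵗ − 1)/(z − 1),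
-- because F satisfies the relation too and the remaining factors cancel.
Δ-pq-formula : ∀ {a p q t} .{{_ : NonZero p}} .{{_ : NonZero q}} .{{_ : NonZero t}} →
  (p⊥q : Coprime p q) → Relation a p q t →
  Δ (p * q) a ≗ Δ p (Δ q (dilate t (NegBitQuotient.σ p q p⊥q)))
Δ-pq-formula {a} {p} {q} {t} p⊥q rel =
  Δ-injective (q * t) {{ℕP.m*n≢0 q t}}
    (Δ-injective (t * p) {{ℕP.m*n≢0 t p}}
      (Δ-injective 1 (λ k → trans (rel k) (sym (F-relation k)))))
  where
  open NegBitQuotient p q p⊥q using (σ; Δ-Δ-σ)
  open ≗-Reasoning
  F = dilate t σ
  denominator : Δs (1 ∷ t * p ∷ q * t ∷ []) F ≗ Δ (p * q * t) (Δ t δ)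
  denominator = begin
    Δ 1 (Δ (t * p) (Δ (q * t) F))       ≈⟨ Δs-cong (1 ∷ t * p ∷ []) (Δ-dilate t q σ) ⟩
    Δ 1 (Δ (t * p) (dilate t (Δ q σ)))  ≈⟨ Δ-cong 1 (Δ-≡ (ℕP.*-comm t p) (dilate t (Δ q σ))) ⟩
    Δ 1 (Δ (p * t) (dilate t (Δ q σ)))  ≈⟨ Δ-cong 1 (Δ-dilate t p (Δ q σ)) ⟩
    Δ 1 (dilate t (Δ p (Δ q σ)))        ≈⟨ Δ-cong 1 (λ k → Δ-Δ-σ (k / t)) ⟩
    Δ 1 (dilate t (Δ (p * q) δ))        ≈⟨ Δ-cong 1 (λ k → sym (Δ-dilate t (p * q) δ k)) ⟩
    Δ 1 (Δ (p * q * t) (dilate t δ))    ≈⟨ Δ-comm 1 (p * q * t) (dilate t δ) ⟩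
    Δ (p * q * t) (Δ 1 (dilate t δ))    ≈⟨ Δ-cong (p * q * t) (Δ-dilate-δ t) ⟩
    Δ (p * q * t) (Δ t δ)               ∎
  F-relation : Δs (1 ∷ t * p ∷ q * t ∷ p ∷ q ∷ []) F ≗ Δs (p ∷ q ∷ t ∷ p * q * t ∷ []) δ
  F-relation = begin
    Δs (1 ∷ t * p ∷ q * t ∷ p ∷ q ∷ []) F
      ≈⟨ Δs-perm (++-comm (1 ∷ t * p ∷ q * t ∷ []) (p ∷ q ∷ [])) F ⟩
    Δs (p ∷ q ∷ 1 ∷ t * p ∷ q * t ∷ []) F
      ≈⟨ Δs-cong (p ∷ q ∷ []) denominator ⟩
    Δs (p ∷ q ∷ p * q * t ∷ t ∷ []) δ
      ≈⟨ Δs-perm (↭-prep p (↭-prep q (↭-swap (p * q * t) t (↭-refl {x = []})))) δ ⟩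
    Δs (p ∷ q ∷ t ∷ p * q * t ∷ []) δ ∎

Bounds : Seq → ℕ → ℕ → ℕ → Set
Bounds a p q t = (∀ m → ∣ Δ (p * q) a m ∣ ≤ 2) × (p + q ≤ t → ∀ m → ∣ Δ (p * q) a m ∣ ≤ 1)

Bounds-swap : ∀ {a} p q {t} → Bounds a p q t → Bounds a q p t
Bounds-swap {a} p q {t} (bound₂ , bound₁) =
  (λ m → swapped (bound₂ m)) , (λ q+p≤t m → swapped (bound₁ (subst (_≤ t) (ℕP.+-comm q p) q+p≤t) m))
  where
  swapped : ∀ {B m} → ∣ Δ (p * q) a m ∣ ≤ B → ∣ Δ (q * p) a m ∣ ≤ B
  swapped {B} {m} = subst (λ v → ∣ v ∣ ≤ B) (Δ-≡ (ℕP.*-comm p q) a m)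

relation-bounds : ∀ {a p q t} .{{_ : NonZero p}} .{{_ : NonZero q}} .{{_ : NonZero t}} →
  Coprime p q → Relation a p q t → Bounds a p q t
relation-bounds {a} {p} {q} {t} p⊥q rel =
    (λ m → via (second-difference-bound p q (λ k → σ-negBit (k / t)) m))
  , (λ p+q≤t m → via (blocked-second-difference-bound p q t σ-negBit p+q≤t m))
  where
  open NegBitQuotient p q p⊥q using (σ; σ-negBit)
  via : ∀ {B m} → ∣ Δ p (Δ q (dilate t σ)) m ∣ ≤ B → ∣ Δ (p * q) a m ∣ ≤ B
  via {B} {m} = subst (λ v → ∣ v ∣ ≤ B) (sym (Δ-pq-formula p⊥q rel m))

coeffℤ-difference-bound : ∀ (Q : Poly) N B → (∀ n → ∣ Δ N (coeff Q) n ∣ ≤ B) →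
  ∀ m → ∣ coeffℤ Q m -ℤ coeffℤ Q (m -ℤ + N) ∣ ≤ B
coeffℤ-difference-bound Q N       B bound (+ n) = subst (_≤ B) (sym same-value) (bound n)
  where
  a = coeff Q
  negative-index : ∀ d → 0 < d → coeffℤ Q (-ℤ (+ d)) ≡ 0ℤ
  negative-index (suc d) _ = refl
  delayed : coeffℤ Q (+ n -ℤ + N) ≡ shift N a n
  delayed with N ≤? n
  ... | yes N≤n = trans (cong (coeffℤ Q) (trans (ℤP.[+m]-[+n]≡m⊖n n N) (ℤP.⊖-≥ N≤n)))
                        (sym (shift-≥ N a n N≤n))
  ... | no  N≰n = trans (cong (coeffℤ Q) (trans (ℤP.[+m]-[+n]≡m⊖n n N) (ℤP.⊖-< n<N)))
                        (trans (negative-index (N ∸ n) (ℕP.m<n⇒0<n∸m n<N)) (sym (shift-< N a n n<N)))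
    where n<N = ℕP.≰⇒> N≰n
  flip-sign : ∀ (u v : ℤ) → u -ℤ v ≡ -ℤ (v -ℤ u)
  flip-sign = solve-∀
  same-value : ∣ a n -ℤ coeffℤ Q (+ n -ℤ + N) ∣ ≡ ∣ Δ N a n ∣
  same-value = trans (cong (λ w → ∣ a n -ℤ w ∣) delayed)
                     (trans (cong ∣_∣ (flip-sign (a n) (shift N a n))) (ℤP.∣-i∣≡∣i∣ (Δ N a n)))
coeffℤ-difference-bound Q zero    B bound -[1+ n ] = z≤n
coeffℤ-difference-bound Q (suc N) B bound -[1+ n ] = z≤n

third : ∀ (i j : Fin 3) → i ≢ j → ∃[ k ] (j ≢ k × i ≢ k)
third 0F 1F _ = 2F , (λ ()) , (λ ())
third 0F 2F _ = 1F , (λ ()) , (λ ())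
third 1F 0F _ = 2F , (λ ()) , (λ ())
third 1F 2F _ = 0F , (λ ()) , (λ ())
third 2F 0F _ = 1F , (λ ()) , (λ ())
third 2F 1F _ = 0F , (λ ()) , (λ ())
third 0F 0F i≢j = ⊥-elim (i≢j refl)
third 1F 1F i≢j = ⊥-elim (i≢j refl)
third 2F 2F i≢j = ⊥-elim (i≢j refl)

-- From the relation for (r 1F, r 2F, r 0F), rotations give the bounds for the
-- pairs (1F, 2F), (2F, 0F), (0F, 1F), and swapping gives the reversed pairs.
pair-bounds : ∀ (r : Fin 3 → ℕ) (a : Seq) → (∀ i → NonZero (r i)) →
  (∀ i j → i ≢ j → Coprime (r i) (r j)) → Relation a (r 1F) (r 2F) (r 0F) →
  ∀ i j k → i ≢ j → j ≢ k → i ≢ k → Bounds a (r i) (r j) (r k)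
pair-bounds r a nonZero coprime rel = bounds
  where
  from-relation : ∀ i j k → i ≢ j → Relation a (r i) (r j) (r k) → Bounds a (r i) (r j) (r k)
  from-relation i j k i≢j = relation-bounds {{nonZero i}} {{nonZero j}} {{nonZero k}} (coprime i j i≢j)
  rel₂₀₁ : Relation a (r 2F) (r 0F) (r 1F)
  rel₂₀₁ = Relation-rotate {p = r 1F} {q = r 2F} {t = r 0F} rel
  rel₀₁₂ : Relation a (r 0F) (r 1F) (r 2F)
  rel₀₁₂ = Relation-rotate {p = r 2F} {q = r 0F} {t = r 1F} rel₂₀₁
  bounds : ∀ i j k → i ≢ j → j ≢ k → i ≢ k → Bounds a (r i) (r j) (r k)
  bounds 1F 2F 0F _ _ _ = from-relation 1F 2F 0F (λ ()) rel
  bounds 2F 0F 1F _ _ _ = from-relation 2F 0F 1F (λ ()) rel₂₀₁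
  bounds 0F 1F 2F _ _ _ = from-relation 0F 1F 2F (λ ()) rel₀₁₂
  bounds 2F 1F 0F _ _ _ = Bounds-swap (r 1F) (r 2F) (bounds 1F 2F 0F (λ ()) (λ ()) (λ ()))
  bounds 0F 2F 1F _ _ _ = Bounds-swap (r 2F) (r 0F) (bounds 2F 0F 1F (λ ()) (λ ()) (λ ()))
  bounds 1F 0F 2F _ _ _ = Bounds-swap (r 0F) (r 1F) (bounds 0F 1F 2F (λ ()) (λ ()) (λ ()))
  bounds 0F 0F _  i≢j _ _ = ⊥-elim (i≢j refl)
  bounds 1F 1F _  i≢j _ _ = ⊥-elim (i≢j refl)
  bounds 2F 2F _  i≢j _ _ = ⊥-elim (i≢j refl)
  bounds _  0F 0F _ j≢k _ = ⊥-elim (j≢k refl)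
  bounds _  1F 1F _ j≢k _ = ⊥-elim (j≢k refl)
  bounds _  2F 2F _ j≢k _ = ⊥-elim (j≢k refl)
  bounds 0F _  0F _ _ i≢k = ⊥-elim (i≢k refl)
  bounds 1F _  1F _ _ i≢k = ⊥-elim (i≢k refl)
  bounds 2F _  2F _ _ i≢k = ⊥-elim (i≢k refl)

lemma4 : (r : Fin 3 → ℕ)
    → (∀ i → 3 ≤ r i)
    → (∀ i j → i ≢ j → Coprime (r i) (r j))
    → (Q : Poly) → IsQθ r Q
    → (∀ i j → i ≢ j → ∀ (m : ℤ) → ∣ coeffℤ Q m -ℤ coeffℤ Q (m -ℤ + (r i * r j)) ∣ ≤ 2)
      × (∀ i j k → i ≢ j → j ≢ k → i ≢ k → r i + r j ≤ r k
           → ∀ (m : ℤ) → ∣ coeffℤ Q m -ℤ coeffℤ Q (m -ℤ + (r i * r j)) ∣ ≤ 1)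
lemma4 r r≥3 coprime Q isQ = bound-two , bound-one
  where
  nonZero : ∀ i → NonZero (r i)
  nonZero i = >-nonZero (ℕP.<-≤-trans (s≤s z≤n) (r≥3 i))
  bounds = pair-bounds r (coeff Q) nonZero coprime (IsQθ⇒Relation r Q isQ)
  bound-two : ∀ i j → i ≢ j → ∀ m → ∣ coeffℤ Q m -ℤ coeffℤ Q (m -ℤ + (r i * r j)) ∣ ≤ 2
  bound-two i j i≢j with third i j i≢j
  ... | k , j≢k , i≢k = coeffℤ-difference-bound Q (r i * r j) 2 (proj₁ (bounds i j k i≢j j≢k i≢k))
  bound-one : ∀ i j k → i ≢ j → j ≢ k → i ≢ k → r i + r j ≤ r k
    → ∀ m → ∣ coeffℤ Q m -ℤ coeffℤ Q (m -ℤ + (r i * r j)) ∣ ≤ 1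
  bound-one i j k i≢j j≢k i≢k r+r≤r =
    coeffℤ-difference-bound Q (r i * r j) 1 (proj₂ (bounds i j k i≢j j≢k i≢k) r+r≤r)
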